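{- For every integer $n>1$, $\overline{\mathrm{spt}}1(n)+\overline{\mathrm{spt}}1(n-1)$ equals the number of overpartitions of $n$ that contain no non-overlined part equal to $1$.
   Context: An overpartition of $n$ is a partition of $n$ in which the first occurrence of each distinct part size may be overlined. For an overpartition $\pi$, $s(\pi)$ denotes its smallest non-overlined part. $\overline{\mathrm{spt}}1(n)$ is the number of overpartitions $\pi$ of $n$ having at least one non-overlined part, such that $s(\pi)$ appears exactly once and every overlined part is strictly bigger than $s(\pi)$. -}

module Defs where

open import Data.Nat using (ℕ; _≤_; _<_; _≥_; _>_; _+_)
open import Data.Nat.Properties using (_≟_)
open import Data.List using (List; length; filter)
open import Data.Nat.ListAction using (sum)
open import Data.List.Relation.Unary.All using (All)
open import Data.List.Relation.Unary.Linked using (Linked)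
open import Data.Product using (Σ; _×_)
open import Relation.Binary.PropositionalEquality using (_≡_)

count : ℕ → List ℕ → ℕ
count k xs = length (filter (_≟ k) xs)

-- An overpartition of n, represented as the pair
--   (list of overlined parts, list of non-overlined parts).
-- Since only the first occurrence of a part size may be overlined, each
-- size occurs at most once overlined: the overlined parts are listed in
-- strictly decreasing order; the non-overlined parts in weakly decreasing
-- order (canonical ordering, so each overpartition has exactly one
-- representation).
record Overpartition (n : ℕ) : Set where
  constructor mkOP
  field
    over       : List ℕ
    plain      : List ℕ
    over-dec   : Linked _>_ over
    plain-dec  : Linked _≥_ plain
    over-pos   : All (1 ≤_) over
    plain-pos  : All (1 ≤_) plain
    total      : sum over + sum plain ≡ n

open Overpartition public

IsSpt1 : ∀ {n} → Overpartition n → Set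
IsSpt1 π = Σ ℕ λ s → (count s (plain π) ≡ 1) × All (s ≤_) (plain π) × All (s <_) (over π)

Spt1Set : ℕ → Set
Spt1Set n = Σ (Overpartition n) IsSpt1

NoPlainOne : ℕ → Set
NoPlainOne n = Σ (Overpartition n) λ π → count 1 (plain π) ≡ 0

-- For π counted by spt1‾ with s = s(π), overlining s gives an overpartition of the same size, and
-- replacing s by s + 1 one of size one larger; in both, every non-overlined part exceeds 1.
-- Conversely, an overpartition of n ≥ 1 without non-overlined 1s comes from the first map when its
-- smallest part is overlined and below every non-overlined part, and from the second otherwise.
module Submission where

open import Defs
open import Data.Nat using (ℕ; _<_; _∸_; _+_)
open import Data.Fin using (Fin)
open import Function.Bundles using (_↔_)
open import Relation.Binary.PropositionalEquality using (_≡_)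

open import Data.Empty using (⊥-elim)
open import Data.Fin.Permutation using (↔⇒≡)
open import Data.Fin.Properties using (+↔⊎)
open import Data.List using (List; []; _∷_; _∷ʳ_; [_]; length; initLast; _∷ʳ′_)
open import Data.List.Properties
  using (∷ʳ-injective; ∷ʳ-injectiveˡ; ∷ʳ-injectiveʳ; filter-none; filter-some; filter-accept; filter-reject)
open import Data.List.Relation.Unary.All as All using (All; []; _∷_)
open import Data.List.Relation.Unary.All.Properties using (∷ʳ⁺; ∷ʳ⁻; ¬Any⇒All¬)
open import Data.List.Relation.Unary.Linked as Linked using (Linked; []; [-]; _∷_)
open import Data.Nat using (zero; suc; _≤_; _≥_; _>_; s≤s; s≤s⁻¹; _≤?_)
open import Data.Nat.ListAction using (sum)
open import Data.Nat.ListAction.Properties using (sum-++)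
open import Data.Nat.Properties
open import Data.Product using (Σ; ∃-syntax; _×_; _,_; proj₁; proj₂)
open import Data.Product.Properties using (Σ-≡,≡→≡)
open import Data.Sum using (_⊎_; inj₁; inj₂)
open import Data.Sum.Function.Propositional using (_⊎-↔_)
open import Function using (_∘_; flip)
open import Function.Bundles using (mk↔ₛ′)
open import Function.Properties.Inverse using (↔-sym; ↔-trans)
open import Relation.Binary.Core using (Rel)
open import Relation.Binary.Definitions using (Transitive)
open import Relation.Binary.PropositionalEquality
  using (_≢_; refl; sym; trans; cong; subst; ≢-sym; module ≡-Reasoning)
open import Relation.Nullary using (Irrelevant; yes; no; contradiction)

module _ {a r} {A : Set a} {R : Rel A r} where

  Linked-∷ʳ⁺ : ∀ {xs y} → Linked R xs → All (λ x → R x y) xs → Linked R (xs ∷ʳ y)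
  Linked-∷ʳ⁺ []          []         = [-]
  Linked-∷ʳ⁺ [-]         (Rxy ∷ []) = Rxy ∷ [-]
  Linked-∷ʳ⁺ (Rxx′ ∷ Rxs) (_ ∷ Rxsy) = Rxx′ ∷ Linked-∷ʳ⁺ Rxs Rxsy

  Linked-∷ʳ⁻ : ∀ xs {y} → Linked R (xs ∷ʳ y) → Linked R xs
  Linked-∷ʳ⁻ []           _            = []
  Linked-∷ʳ⁻ (_ ∷ [])     _            = [-]
  Linked-∷ʳ⁻ (_ ∷ x ∷ xs) (Rxx′ ∷ Rxs) = Rxx′ ∷ Linked-∷ʳ⁻ (x ∷ xs) Rxs

  Linked-∷ʳ⇒All : Transitive R → ∀ xs {y} → Linked R (xs ∷ʳ y) → All (λ x → R x y) xs
  Linked-∷ʳ⇒All _     []           _            = []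
  Linked-∷ʳ⇒All _     (_ ∷ [])     (Rxy ∷ [-])  = Rxy ∷ []
  Linked-∷ʳ⇒All trans (_ ∷ x ∷ xs) (Rxx′ ∷ Rxs) = trans Rxx′ (All.head ih) ∷ ih
    where ih = Linked-∷ʳ⇒All trans (x ∷ xs) Rxs

count-≡0 : ∀ {k xs} → All (_≢ k) xs → count k xs ≡ 0
count-≡0 {k} xs≢k = cong length (filter-none (_≟ k) xs≢k)

count-∷-≡ : ∀ {k x} xs → x ≡ k → count k (x ∷ xs) ≡ suc (count k xs)
count-∷-≡ {k} _ x≡k = cong length (filter-accept (_≟ k) x≡k)

count-∷-≢ : ∀ {k x} xs → x ≢ k → count k (x ∷ xs) ≡ count k xs
count-∷-≢ {k} _ x≢k = cong length (filter-reject (_≟ k) x≢k)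

count≡0⇒All≢ : ∀ {k} xs → count k xs ≡ 0 → All (_≢ k) xs
count≡0⇒All≢ {k} xs none = ¬Any⇒All¬ xs (λ some → <⇒≢ (filter-some (_≟ k) some) (sym none))

count-∷ʳ-self : ∀ {k xs} → All (_≢ k) xs → count k (xs ∷ʳ k) ≡ 1
count-∷ʳ-self {k} {[]}     []          = count-∷-≡ {k} [] refl
count-∷ʳ-self {k} {_ ∷ xs} (x≢k ∷ xs≢k) = trans (count-∷-≢ (xs ∷ʳ k) x≢k) (count-∷ʳ-self xs≢k)

sum-∷ʳ : ∀ xs y → sum (xs ∷ʳ y) ≡ sum xs + y
sum-∷ʳ xs y = trans (sum-++ xs [ y ]) (cong (sum xs +_) (+-identityʳ y))

sum-∷ʳ-suc : ∀ xs y → sum (xs ∷ʳ suc y) ≡ suc (sum (xs ∷ʳ y))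
sum-∷ʳ-suc xs y = begin
  sum (xs ∷ʳ suc y)  ≡⟨ sum-∷ʳ xs (suc y) ⟩
  sum xs + suc y     ≡⟨ +-suc (sum xs) y ⟩
  suc (sum xs + y)   ≡⟨ cong suc (sum-∷ʳ xs y) ⟨
  suc (sum (xs ∷ʳ y)) ∎
  where open ≡-Reasoning

sum-∷ʳ-move : ∀ xs ys y → sum (xs ∷ʳ y) + sum ys ≡ sum xs + sum (ys ∷ʳ y)
sum-∷ʳ-move xs ys y = begin
  sum (xs ∷ʳ y) + sum ys  ≡⟨ cong (_+ sum ys) (sum-∷ʳ xs y) ⟩
  sum xs + y + sum ys     ≡⟨ +-assoc (sum xs) y (sum ys) ⟩
  sum xs + (y + sum ys)   ≡⟨ cong (sum xs +_) (+-comm y (sum ys)) ⟩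
  sum xs + (sum ys + y)   ≡⟨ cong (sum xs +_) (sum-∷ʳ ys y) ⟨
  sum xs + sum (ys ∷ʳ y)  ∎
  where open ≡-Reasoning

split-unique-minimum : ∀ {s} {P : List ℕ} → Linked _≥_ P → All (s ≤_) P → count s P ≡ 1 →
                       ∃[ P′ ] P ≡ P′ ∷ʳ s × All (s <_) P′
split-unique-minimum {s} {x ∷ xs} sorted (s≤x ∷ s≤xs) once with x ≟ s
... | yes refl = [] , cong (x ∷_) (onlyHead sorted s≤xs others≢x) , []
  where
  others≢x : All (_≢ x) xs
  others≢x = count≡0⇒All≢ xs (suc-injective (trans (sym (count-∷-≡ xs refl)) once))

  onlyHead : ∀ {ys} → Linked _≥_ (x ∷ ys) → All (x ≤_) ys → All (_≢ x) ys → ys ≡ []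
  onlyHead {[]}    _         _         _         = refl
  onlyHead {_ ∷ _} (x≥y ∷ _) (x≤y ∷ _) (y≢x ∷ _) = contradiction (≤-antisym x≥y x≤y) y≢x
... | no x≢s =
  let P′ , P≡ , s<P′ = split-unique-minimum (Linked.tail sorted) s≤xs
                                             (trans (sym (count-∷-≢ xs x≢s)) once)
  in  x ∷ P′ , cong (x ∷_) P≡ , ≤∧≢⇒< s≤x (≢-sym x≢s) ∷ s<P′

Σ-Overpartition-≡ : ∀ {n} {P : Overpartition n → Set} → (∀ {π} → Irrelevant (P π)) →
                    {x y : Σ (Overpartition n) P} →
                    over (proj₁ x) ≡ over (proj₁ y) → plain (proj₁ x) ≡ plain (proj₁ y) → x ≡ y
Σ-Overpartition-≡ P-irrelevant {mkOP _ _ o> p≥ o+ p+ t , _} {mkOP _ _ o>′ p≥′ o+′ p+′ t′ , _}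
                  refl refl
  rewrite Linked.irrelevant <-irrelevant o> o>′ | Linked.irrelevant ≤-irrelevant p≥ p≥′
        | All.irrelevant ≤-irrelevant o+ o+′  | All.irrelevant ≤-irrelevant p+ p+′
        | ≡-irrelevant t t′
  = Σ-≡,≡→≡ (refl , P-irrelevant _ _)

module _ {n : ℕ} (x : Spt1Set n) where

  private
    π = proj₁ x

  smallest : ℕ
  smallest = proj₁ (proj₂ x)

  private
    split : ∃[ P′ ] plain π ≡ P′ ∷ʳ smallest × All (smallest <_) P′
    split = let (_ , once , s≤P , _) = proj₂ x in split-unique-minimum (plain-dec π) s≤P once

  larger : List ℕ
  larger = proj₁ split

  plain≡larger∷ʳsmallest : plain π ≡ larger ∷ʳ smallest
  plain≡larger∷ʳsmallest = proj₁ (proj₂ split)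

  smallest<larger : All (smallest <_) larger
  smallest<larger = proj₂ (proj₂ split)

  larger-unique : ∀ {P′} → plain π ≡ P′ ∷ʳ smallest → larger ≡ P′
  larger-unique P≡ = ∷ʳ-injectiveˡ larger _ (trans (sym plain≡larger∷ʳsmallest) P≡)

  smallest-positive : 1 ≤ smallest
  smallest-positive = proj₂ (∷ʳ⁻ (subst (All (1 ≤_)) plain≡larger∷ʳsmallest (plain-pos π)))

  larger>1 : All (1 <_) larger
  larger>1 = All.map (≤-<-trans smallest-positive) smallest<larger

  larger-dec : Linked _≥_ larger
  larger-dec = Linked-∷ʳ⁻ larger (subst (Linked _≥_) plain≡larger∷ʳsmallest (plain-dec π))

  total-split : sum (over π) + sum (larger ∷ʳ smallest) ≡ n
  total-split = trans (cong ((sum (over π) +_) ∘ sum) (sym plain≡larger∷ʳsmallest)) (total π)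

IsSpt1-irrelevant : ∀ {n} {π : Overpartition n} → Irrelevant (IsSpt1 π)
IsSpt1-irrelevant {π = π} i@(_ , once , s≤P , s<O) j@(_ , once′ , s≤P′ , s<O′)
  with refl ← ∷ʳ-injectiveʳ (larger (π , i)) (larger (π , j))
                (trans (sym (plain≡larger∷ʳsmallest (π , i))) (plain≡larger∷ʳsmallest (π , j)))
  rewrite ≡-irrelevant once once′ | All.irrelevant ≤-irrelevant s≤P s≤P′
        | All.irrelevant <-irrelevant s<O s<O′
  = refl

Spt1-≡ : ∀ {n} {x y : Spt1Set n} →
         over (proj₁ x) ≡ over (proj₁ y) → plain (proj₁ x) ≡ plain (proj₁ y) → x ≡ y
Spt1-≡ = Σ-Overpartition-≡ (λ {π} → IsSpt1-irrelevant {π = π})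

NoPlainOne-≡ : ∀ {n} {x y : NoPlainOne n} →
               over (proj₁ x) ≡ over (proj₁ y) → plain (proj₁ x) ≡ plain (proj₁ y) → x ≡ y
NoPlainOne-≡ = Σ-Overpartition-≡ ≡-irrelevant

overlineSmallest : ∀ {n} → Spt1Set n → NoPlainOne n
overlineSmallest {n} x@(π , s , _ , _ , s<O) =
  mkOP (over π ∷ʳ s) (larger x) (Linked-∷ʳ⁺ (over-dec π) s<O) (larger-dec x)
       (∷ʳ⁺ (over-pos π) (smallest-positive x)) (All.map <⇒≤ (larger>1 x)) total′ ,
  count-≡0 (All.map >⇒≢ (larger>1 x))
  where
  total′ : sum (over π ∷ʳ s) + sum (larger x) ≡ n
  total′ = trans (sum-∷ʳ-move (over π) (larger x) s) (total-split x)

incrementSmallest : ∀ {n} → Spt1Set n → NoPlainOne (suc n)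
incrementSmallest {n} x@(π , s , _ , _ , _) =
  mkOP (over π) (larger x ∷ʳ suc s) (over-dec π) (Linked-∷ʳ⁺ (larger-dec x) (smallest<larger x))
       (over-pos π) (All.map <⇒≤ P>1) total′ ,
  count-≡0 (All.map >⇒≢ P>1)
  where
  P>1 : All (1 <_) (larger x ∷ʳ suc s)
  P>1 = ∷ʳ⁺ (larger>1 x) (s≤s (smallest-positive x))

  total′ : sum (over π) + sum (larger x ∷ʳ suc s) ≡ suc n
  total′ = begin
    sum (over π) + sum (larger x ∷ʳ suc s)     ≡⟨ cong (sum (over π) +_) (sum-∷ʳ-suc (larger x) s) ⟩
    sum (over π) + suc (sum (larger x ∷ʳ s))   ≡⟨ +-suc (sum (over π)) _ ⟩
    suc (sum (over π) + sum (larger x ∷ʳ s))   ≡⟨ cong suc (total-split x) ⟩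
    suc n                                      ∎
    where open ≡-Reasoning

unoverlineSmallest : ∀ {n} (π : Overpartition n) {os o} →
                     over π ≡ os ∷ʳ o → All (o <_) (plain π) → Spt1Set n
unoverlineSmallest {n} π {os} {o} O≡ o<P =
  mkOP os (plain π ∷ʳ o) (Linked-∷ʳ⁻ os O-dec) (Linked-∷ʳ⁺ (plain-dec π) (All.map <⇒≤ o<P))
       (proj₁ (∷ʳ⁻ O-pos)) (∷ʳ⁺ (plain-pos π) (proj₂ (∷ʳ⁻ O-pos))) total′ ,
  o , count-∷ʳ-self (All.map >⇒≢ o<P) , ∷ʳ⁺ (All.map <⇒≤ o<P) ≤-refl ,
  Linked-∷ʳ⇒All (flip <-trans) os O-dec
  where
  O-dec : Linked _>_ (os ∷ʳ o)
  O-dec = subst (Linked _>_) O≡ (over-dec π)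

  O-pos : All (1 ≤_) (os ∷ʳ o)
  O-pos = subst (All (1 ≤_)) O≡ (over-pos π)

  total′ : sum os + sum (plain π ∷ʳ o) ≡ n
  total′ = begin
    sum os + sum (plain π ∷ʳ o)    ≡⟨ sum-∷ʳ-move os (plain π) o ⟨
    sum (os ∷ʳ o) + sum (plain π)  ≡⟨ cong ((_+ sum (plain π)) ∘ sum) O≡ ⟨
    sum (over π) + sum (plain π)   ≡⟨ total π ⟩
    n                              ∎
    where open ≡-Reasoning

decrementSmallest : ∀ {n} (π : Overpartition (suc n)) {ps q} →
                    plain π ≡ ps ∷ʳ suc q → 1 ≤ q → All (q <_) (over π) → Spt1Set n
decrementSmallest {n} π {ps} {q} P≡ 1≤q q<O =
  mkOP (over π) (ps ∷ʳ q) (over-dec π) (Linked-∷ʳ⁺ (Linked-∷ʳ⁻ ps P-dec) (All.map <⇒≤ q<ps))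
       (over-pos π) (∷ʳ⁺ (proj₁ (∷ʳ⁻ P-pos)) 1≤q) total′ ,
  q , count-∷ʳ-self (All.map >⇒≢ q<ps) , ∷ʳ⁺ (All.map <⇒≤ q<ps) ≤-refl , q<O
  where
  P-dec : Linked _≥_ (ps ∷ʳ suc q)
  P-dec = subst (Linked _≥_) P≡ (plain-dec π)

  P-pos : All (1 ≤_) (ps ∷ʳ suc q)
  P-pos = subst (All (1 ≤_)) P≡ (plain-pos π)

  q<ps : All (q <_) ps
  q<ps = Linked-∷ʳ⇒All (flip ≤-trans) ps P-dec

  total′ : sum (over π) + sum (ps ∷ʳ q) ≡ n
  total′ = suc-injective (begin
    suc (sum (over π) + sum (ps ∷ʳ q))   ≡⟨ +-suc (sum (over π)) _ ⟨
    sum (over π) + suc (sum (ps ∷ʳ q))   ≡⟨ cong (sum (over π) +_) (sum-∷ʳ-suc ps q) ⟨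
    sum (over π) + sum (ps ∷ʳ suc q)     ≡⟨ cong ((sum (over π) +_) ∘ sum) P≡ ⟨
    sum (over π) + sum (plain π)         ≡⟨ total π ⟩
    suc n                                ∎)
    where open ≡-Reasoning

data SmallestPart {n} (π : Overpartition n) : Set where
  overlined    : ∀ os o → over π ≡ os ∷ʳ o → All (o <_) (plain π) → SmallestPart π
  nonOverlined : ∀ ps p → plain π ≡ ps ∷ʳ p → All (p ≤_) (over π) → SmallestPart π

smallestPart : ∀ {m} (π : Overpartition (suc m)) → SmallestPart π
smallestPart (mkOP O P O-dec P-dec _ _ total) with initLast O | initLast P
... | []       | []       = contradiction total 0≢1+n
... | os ∷ʳ′ o | []       = overlined os o refl []
... | []       | ps ∷ʳ′ p = nonOverlined ps p refl []
... | os ∷ʳ′ o | ps ∷ʳ′ p with p ≤? o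
...   | yes p≤o = nonOverlined ps p refl (∷ʳ⁺ (All.map (λ o<y → ≤-trans p≤o (<⇒≤ o<y)) o<os) p≤o)
  where o<os = Linked-∷ʳ⇒All (flip <-trans) os O-dec
...   | no  p≰o = overlined os o refl (∷ʳ⁺ (All.map (<-≤-trans (≰⇒> p≰o)) p≤ps) (≰⇒> p≰o))
  where p≤ps = Linked-∷ʳ⇒All (flip ≤-trans) ps P-dec

plain≥2 : ∀ {n} (y : NoPlainOne n) → All (2 ≤_) (plain (proj₁ y))
plain≥2 (π , noOne) = All.zipWith (λ (1≤y , y≢1) → ≤∧≢⇒< 1≤y (≢-sym y≢1))
                                  (plain-pos π , count≡0⇒All≢ (plain π) noOne)

last-plain≥2 : ∀ {n} (y : NoPlainOne n) {ps p} → plain (proj₁ y) ≡ ps ∷ʳ p → 2 ≤ p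
last-plain≥2 y P≡ = proj₂ (∷ʳ⁻ (subst (All (2 ≤_)) P≡ (plain≥2 y)))

fromSmallestPart : ∀ {m} (y : NoPlainOne (suc m)) → SmallestPart (proj₁ y) →
                   Spt1Set (suc m) ⊎ Spt1Set m
fromSmallestPart (π , _) (overlined _ _ O≡ o<P)         = inj₁ (unoverlineSmallest π O≡ o<P)
fromSmallestPart y       (nonOverlined _ zero P≡ _)     = ⊥-elim (n≮0 (last-plain≥2 y P≡))
fromSmallestPart y       (nonOverlined _ (suc _) P≡ p≤O) =
  inj₂ (decrementSmallest (proj₁ y) P≡ (s≤s⁻¹ (last-plain≥2 y P≡)) p≤O)

toNoPlainOne : ∀ {m} → Spt1Set (suc m) ⊎ Spt1Set m → NoPlainOne (suc m)
toNoPlainOne (inj₁ x) = overlineSmallest x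
toNoPlainOne (inj₂ x) = incrementSmallest x

toNoPlainOne-fromSmallestPart : ∀ {m} (y : NoPlainOne (suc m)) (k : SmallestPart (proj₁ y)) →
                                toNoPlainOne (fromSmallestPart y k) ≡ y
toNoPlainOne-fromSmallestPart (π , _) (overlined _ _ O≡ o<P) =
  NoPlainOne-≡ (sym O≡) (larger-unique (unoverlineSmallest π O≡ o<P) refl)
toNoPlainOne-fromSmallestPart y (nonOverlined _ zero P≡ _) = ⊥-elim (n≮0 (last-plain≥2 y P≡))
toNoPlainOne-fromSmallestPart y@(π , _) (nonOverlined _ (suc q) P≡ p≤O) =
  NoPlainOne-≡ refl (trans (cong (_∷ʳ suc q) (larger-unique x refl)) (sym P≡))
  where x = decrementSmallest π P≡ (s≤s⁻¹ (last-plain≥2 y P≡)) p≤O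

fromSmallestPart-toNoPlainOne : ∀ {m} (x : Spt1Set (suc m) ⊎ Spt1Set m)
                                (k : SmallestPart (proj₁ (toNoPlainOne x))) →
                                fromSmallestPart (toNoPlainOne x) k ≡ x
fromSmallestPart-toNoPlainOne (inj₁ x@(π , _)) (overlined os _ O≡ _)
  with refl , refl ← ∷ʳ-injective (over π) os O≡
  = cong inj₁ (Spt1-≡ refl (sym (plain≡larger∷ʳsmallest x)))
fromSmallestPart-toNoPlainOne (inj₁ x) (nonOverlined _ _ P≡ p≤O) =
  ⊥-elim (<⇒≱ s<p (proj₂ (∷ʳ⁻ p≤O)))
  where s<p = proj₂ (∷ʳ⁻ (subst (All (smallest x <_)) P≡ (smallest<larger x)))
fromSmallestPart-toNoPlainOne (inj₂ (_ , _ , _ , _ , s<O)) (overlined _ _ O≡ o<P) =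
  ⊥-elim (<⇒≱ (proj₂ (∷ʳ⁻ (subst (All (_ <_)) O≡ s<O))) (s≤s⁻¹ (proj₂ (∷ʳ⁻ o<P))))
fromSmallestPart-toNoPlainOne (inj₂ x) (nonOverlined _ zero P≡ _) =
  ⊥-elim (n≮0 (last-plain≥2 (incrementSmallest x) P≡))
fromSmallestPart-toNoPlainOne (inj₂ x@(_ , _ , _)) (nonOverlined ps (suc _) P≡ _)
  with refl , refl ← ∷ʳ-injective (larger x) ps P≡
  = cong inj₂ (Spt1-≡ refl (sym (plain≡larger∷ʳsmallest x)))

spt1⊎spt1↔noPlainOne : ∀ {m} → (Spt1Set (suc m) ⊎ Spt1Set m) ↔ NoPlainOne (suc m)
spt1⊎spt1↔noPlainOne = mk↔ₛ′ toNoPlainOne from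
  (λ y → toNoPlainOne-fromSmallestPart y (smallestPart (proj₁ y)))
  (λ x → fromSmallestPart-toNoPlainOne x (smallestPart (proj₁ (toNoPlainOne x))))
  where from = λ y → fromSmallestPart y (smallestPart (proj₁ y))

-- The bijection exists for every n ≥ 1.
corollary4p1 : (n : ℕ) → 1 < n → (a b c : ℕ) →
    Spt1Set n ↔ Fin a → Spt1Set (n ∸ 1) ↔ Fin b → NoPlainOne n ↔ Fin c →
    a + b ≡ c
corollary4p1 (suc m) _ _ _ _ spt1[n]↔a spt1[n-1]↔b noPlainOne↔c =
  ↔⇒≡ (↔-trans +↔⊎ (↔-trans (↔-sym spt1[n]↔a ⊎-↔ ↔-sym spt1[n-1]↔b)
                            (↔-trans spt1⊎spt1↔noPlainOne noPlainOne↔c)))
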